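{- Let $\pmb\lambda$ be a $d$-tuple of partitions of $m$ and let $T\in A(\pmb\lambda')\setminus B(\pmb\lambda')$, i.e. $T$ has two equal columns. If $d$ is odd then $\Delta_T=0$, and if $d$ is even then $\nabla_T=0$.
   Context: $V=(\mathbb C^n)^{\otimes d}$ with basis $e_{\mathbf i}=e_{i_1}\otimes\cdots\otimes e_{i_d}$, $\mathbf i\in[n]^d$; $\bigvee V$ is the symmetric algebra (polynomial ring in commuting variables $e_{\mathbf i}$), $\bigwedge V$ the exterior algebra. $\pmb\lambda'$ is the componentwise conjugate. For a sequence $\alpha$ with sum $m$, $A(\alpha)$ is the set of words of length $m$ in which letter $i$ occurs $\alpha_i$ times; $A(\pmb\alpha)=A(\alpha^{(1)})\times\cdots\times A(\alpha^{(d)})$ viewed as $d\times m$ tables with columns $T(1),\dots,T(m)$; $B(\pmb\alpha)$ is the set of those with pairwise distinct columns. $\|T\|=\prod_{\mathbf c}(\#\{j:T(j)=\mathbf c\})!$. $\bigvee e_X=e_{X(1)}\cdots e_{X(m)}$, $\bigwedge e_X=e_{X(1)}\wedge\cdots\wedge e_{X(m)}$. Signs: $(-1)^w=(-1)^{\#\{i<j:w_i>w_j\}}$; $(-1)^T=\prod_i(-1)^{t_i}$ over rows. For words $s,x$ of length $m$, $\mathrm{sgn}_s(x)=\prod_c\mathrm{sgn}(x_{b_1},\dots,x_{b_k})$ over letters $c$ of $s$ with positions $b_1<\dots<b_k$, where $\mathrm{sgn}(a_1,\dots,a_k)$ is the permutation sign if $(a_1,\dots,a_k)$ is a permutation of $[k]$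 and $0$ otherwise; $\mathrm{sgn}_T(X)=\prod_i\mathrm{sgn}_{t_i}(x_i)$. Vectors: for a $d\times m$ table $T$ of positive integers, $\Delta_T=\frac{(-1)^T}{\|T\|}\sum_X\mathrm{sgn}_T(X)\bigvee e_X$ and $\nabla_T=\frac{(-1)^T}{\|T\|}\sum_X\mathrm{sgn}_T(X)\bigwedge e_X$, sums over all $d\times m$ tables $X$ with entries in $[n]$. -}

module Defs where

open import Data.Nat as ℕ using (ℕ; zero; suc; _≤_; _<_; _≤?_; _<?_; _⊔_; _!; NonZero)
open import Data.Nat.Properties using (_!≢0; m*n≢0)
import Data.Nat.Properties as ℕP
open import Data.Integer as ℤ using (ℤ; +_)
open import Data.Rational as ℚ using (ℚ)
open import Data.Fin as Fin using (Fin; toℕ)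
open import Data.Fin.Properties as FinP using ()
open import Data.List as List using (List; []; _∷_; length; filter; map; upTo; zip; deduplicate; foldr)
open import Data.List.Membership.Propositional using (_∈_)
open import Data.List.Relation.Unary.All as All using (All)
open import Data.List.Relation.Unary.AllPairs using (AllPairs)
open import Data.Vec as Vec using (Vec; toList)
import Data.Vec.Properties as VecP
open import Data.Product using (_×_; _,_; proj₁; proj₂; Σ; ∃)
open import Relation.Binary.PropositionalEquality using (_≡_; _≢_)
open import Relation.Nullary using (yes; no; ¬_)
open import Relation.Nullary.Decidable using (⌊_⌋)
open import Data.Bool using (Bool; true; false; if_then_else_)
open import Function using (_∘_)

open import Relation.Unary using (Decidable)

count : ∀ {A : Set} {P : A → Set} → Decidable P → List A → ℕ
count P? xs = length (filter P? xs)

sumℕ : List ℕ → ℕ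
sumℕ = foldr ℕ._+_ 0

prodℕ : List ℕ → ℕ
prodℕ = foldr ℕ._*_ 1

sumℤ : List ℤ → ℤ
sumℤ = foldr ℤ._+_ (+ 0)

prodℤ : List ℤ → ℤ
prodℤ = foldr ℤ._*_ (+ 1)

sumℚ : List ℚ → ℚ
sumℚ = foldr ℚ._+_ ℚ.0ℚ

IsPartition : ℕ → List ℕ → Set
IsPartition m λ′ = AllPairs (λ a b → b ≤ a) λ′ × All (λ a → 1 ≤ a) λ′ × sumℕ λ′ ≡ m

conj : List ℕ → List ℕ
conj λ′ = map (λ j → count (λ a → suc j ≤? a) λ′) (upTo (foldr _⊔_ 0 λ′))

-- A(α): words (letters are positive integers) in which letter i (1-based)
-- occurs exactly α_i times, and only letters 1..length α occur
InA : List ℕ → List ℕ → Set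
InA α w = All (λ a → 1 ≤ a × a ≤ length α) w
        × ((j : Fin (length α)) → count (λ a → a ℕ.≟ suc (toℕ j)) w ≡ List.lookup α j)

Table : Set → ℕ → ℕ → Set
Table A d m = Vec (Vec A m) d

column : ∀ {A d m} → Table A d m → Fin m → Vec A d
column X j = Vec.map (λ row → Vec.lookup row j) X

columns : ∀ {A d m} → Table A d m → List (Vec A d)
columns {m = m} X = List.tabulate (column X)

allVec : ∀ {A : Set} (k : ℕ) → List A → List (Vec A k)
allVec zero    xs = Vec.[] ∷ []
allVec (suc k) xs = List.concatMap (λ x → map (x Vec.∷_) (allVec k xs)) xs

allFin : (n : ℕ) → List (Fin n)
allFin n = List.allFin n

-- all d × m tables with entries in [n]  (Fin n, entry a stands for a+1)
allTables : (n d m : ℕ) → List (Table (Fin n) d m)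
allTables n d m = allVec d (allVec m (allFin n))

inv : List ℕ → ℕ
inv []       = 0
inv (x ∷ xs) = count (λ y → y <? x) xs ℕ.+ inv xs

negOnePow : ℕ → ℤ
negOnePow zero          = + 1
negOnePow (suc zero)    = ℤ.- (+ 1)
negOnePow (suc (suc k)) = negOnePow k

signWord : List ℕ → ℤ
signWord w = negOnePow (inv w)

allB : ∀ {A : Set} → (A → Bool) → List A → Bool
allB p = foldr (λ a b → if p a then b else false) true

isPermWord : List ℕ → Bool
isPermWord as = allB (λ v → ⌊ count (λ a → a ℕ.≟ suc v) as ℕ.≟ 1 ⌋) (upTo (length as))

sgn : List ℕ → ℤ
sgn as = if isPermWord as then signWord as else + 0

sgnRel : List ℕ → List ℕ → ℤ
sgnRel s x = prodℤ (map (λ c → sgn (map proj₂ (filter (λ p → proj₁ p ℕ.≟ c) (zip s x))))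
                        (deduplicate ℕ._≟_ s))

-- entries of X are in [n]; Fin n element a represents a+1
finWord : ∀ {n m} → Vec (Fin n) m → List ℕ
finWord v = map (suc ∘ toℕ) (toList v)

sgnT : ∀ {n d m} → Table ℕ d m → Table (Fin n) d m → ℤ
sgnT T X = prodℤ (toList (Vec.zipWith (λ t x → sgnRel (toList t) (finWord x)) T X))

signT : ∀ {d m} → Table ℕ d m → ℤ
signT T = prodℤ (toList (Vec.map (signWord ∘ toList) T))

normT : ∀ {d m} → Table ℕ d m → ℕ
normT T = prodℕ (map _! (map (λ c → count (λ c′ → VecP.≡-dec ℕ._≟_ c′ c) (columns T))
                              (deduplicate (VecP.≡-dec ℕ._≟_) (columns T))))

prodFact-nonZero : (xs : List ℕ) → NonZero (prodℕ (map _! xs))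
prodFact-nonZero []       = _
prodFact-nonZero (x ∷ xs) = m*n≢0 (x !) (prodℕ (map _! xs)) {{x !≢0}} {{prodFact-nonZero xs}}

normT-nonZero : ∀ {d m} (T : Table ℕ d m) → NonZero (normT T)
normT-nonZero T =
  prodFact-nonZero (map (λ c → count (λ c′ → VecP.≡-dec ℕ._≟_ c′ c) (columns T))
                        (deduplicate (VecP.≡-dec ℕ._≟_) (columns T)))

coeff : ∀ {n d m} → Table ℕ d m → Table (Fin n) d m → ℚ
coeff T X = ((signT T ℤ.* sgnT T X) ℚ./ normT T) {{normT-nonZero T}}

-- Symmetric / exterior powers of V = (ℂ^n)^{⊗d}, modelled concretely.
--
-- A monomial ∨e_X (resp. ∧e_X), X a d × m table over [n], is the product of
-- the basis vectors e_{X(1)},...,e_{X(m)} indexed by the columns of X.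
-- The coefficient of the standard basis vector e_{Y(1)}⋯e_{Y(m)} of
-- Sym^m V (resp. e_{Y(1)}∧⋯∧e_{Y(m)} of Λ^m V) in a linear combination
-- is extracted by the canonical dual pairing:
--   ⟨Y , ∨e_X⟩ = permanent [ X(j) = Y(k) ]_{j,k}
--   ⟨Y , ∧e_X⟩ = determinant [ X(j) = Y(k) ]_{j,k}
-- (Leibniz formula, summing over all maps σ : [m] → [m], weighted by sgn σ,
-- which is 0 on non-permutations).  An element of Sym^m V / Λ^m V is zero
-- iff all these pairings vanish (characteristic 0).

delta : ∀ {k} → Vec ℕ k → Vec ℕ k → ℤ
delta a b with VecP.≡-dec ℕ._≟_ a b
... | yes _ = + 1
... | no  _ = + 0

finCols : ∀ {n d m} → Table (Fin n) d m → Fin m → Vec ℕ d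
finCols X j = Vec.map (suc ∘ toℕ) (column X j)

matchProd : ∀ {n d m} → Table (Fin n) d m → Table (Fin n) d m → Vec (Fin m) m → ℤ
matchProd {m = m} Y X σ =
  prodℤ (List.tabulate (λ j → delta (finCols X j) (finCols Y (Vec.lookup σ j))))

sgnMap : ∀ {m} → Vec (Fin m) m → ℤ
sgnMap σ = sgn (finWord σ)

symPair : ∀ {n d m} → Table (Fin n) d m → Table (Fin n) d m → ℤ
symPair {m = m} Y X =
  sumℤ (map (λ σ → (sgnMap σ ℤ.* sgnMap σ) ℤ.* matchProd Y X σ) (allVec m (allFin m)))

extPair : ∀ {n d m} → Table (Fin n) d m → Table (Fin n) d m → ℤ
extPair {m = m} Y X =
  sumℤ (map (λ σ → sgnMap σ ℤ.* matchProd Y X σ) (allVec m (allFin m)))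

-- coefficient of e_Y in Δ_T = (-1)^T/‖T‖ Σ_X sgn_T(X) ∨e_X
DeltaCoeff : (n : ℕ) → ∀ {d m} → Table ℕ d m → Table (Fin n) d m → ℚ
DeltaCoeff n {d} {m} T Y =
  sumℚ (map (λ X → coeff T X ℚ.* (symPair Y X ℚ./ 1)) (allTables n d m))

-- coefficient of e_Y in ∇_T = (-1)^T/‖T‖ Σ_X sgn_T(X) ∧e_X
NablaCoeff : (n : ℕ) → ∀ {d m} → Table ℕ d m → Table (Fin n) d m → ℚ
NablaCoeff n {d} {m} T Y =
  sumℚ (map (λ X → coeff T X ℚ.* (extPair Y X ℚ./ 1)) (allTables n d m))

DeltaZero : (n : ℕ) → ∀ {d m} → Table ℕ d m → Set
DeltaZero n {d} {m} T = (Y : Table (Fin n) d m) → DeltaCoeff n T Y ≡ ℚ.0ℚ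

NablaZero : (n : ℕ) → ∀ {d m} → Table ℕ d m → Set
NablaZero n {d} {m} T = (Y : Table (Fin n) d m) → NablaCoeff n T Y ≡ ℚ.0ℚ

InAtuple : ∀ {d m} → Vec (List ℕ) d → Table ℕ d m → Set
InAtuple λs T = (i : Fin _) → InA (conj (Vec.lookup λs i)) (toList (Vec.lookup T i))

HasEqualColumns : ∀ {d m} → Table ℕ d m → Set
HasEqualColumns T = ∃ λ j → ∃ λ k → j ≢ k × column T j ≡ column T k

Odd Even : ℕ → Set
Odd d  = d ℕ.% 2 ≡ 1
Even d = d ℕ.% 2 ≡ 0

-- Let columns j < k of T be equal and let φ exchange columns j and k of a table X.
-- Exchanging two entries of a word negates sgn: a word with a repeated letter has sign 0,
-- and otherwise the number of inversions changes parity. Each row t of T carries the same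
-- letter at positions j and k, so in sgn_t(x) only the factor of that letter is affected,
-- and sgn_T(φX) = (-1)^d sgn_T(X). In the Leibniz expansions of the pairings, φ amounts to
-- composing σ with the transposition (j k): pairing e_Y with ∨e_{φX} gives the same value as
-- with ∨e_X, and with ∧e_{φX} the opposite value. Hence for d odd in ⋁V, and for d even in ⋀V,
-- the summand at φX is minus the summand at X; as φ is an involution of the set of tables,
-- each coefficient equals its own negative and vanishes.

module Submission where

open import Defs
open import Data.Nat using (ℕ)
open import Data.List using (List)
open import Data.Vec using (Vec)
open import Data.Fin using (Fin)
open import Data.Product using (_×_)

open import Algebra.Structures using (IsCommutativeMonoid)
import Data.Rational.Properties as ℚP
open import Algebra.Properties.Group ℚP.+-0-group using () renaming (⁻¹-involutive to ℚ-neg-involutive)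
open import Data.Bool using (Bool; true; false; T; if_then_else_)
open import Data.Empty using (⊥; ⊥-elim)
import Data.Fin as F
import Data.Fin.Properties as FP
open import Data.Fin.Permutation.Components using (transpose)
open import Data.Integer as ℤ using (ℤ; +_; +[1+_]; -[1+_])
import Data.Integer.Properties as ℤP
import Data.Integer.Tactic.RingSolver as ℤSolver
open import Data.List as L using ([]; _∷_; _++_; [_]; length; filter; map; zip; foldr; upTo; deduplicate; tabulate)
import Data.List.Properties as LP
open import Data.List.Membership.Propositional using (_∈_; _∉_)
import Data.List.Membership.Propositional.Properties as MP
open import Data.List.Membership.Propositional.Properties.WithK using (unique∧set⇒bag)
open import Data.List.Membership.DecPropositional Data.Nat._≟_ using (_∈?_)
open import Data.List.Relation.Binary.BagAndSetEquality using (∼bag⇒↭)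
open import Data.List.Relation.Binary.Permutation.Propositional using (_↭_; prep; swap; ↭-refl; ↭-sym; ↭-trans; ↭⇒↭ₛ; module PermutationReasoning)
import Data.List.Relation.Binary.Permutation.Propositional.Properties as PermP
open import Data.List.Relation.Binary.Permutation.Setoid.Properties using (foldr-commMonoid)
open import Data.List.Relation.Unary.All as All using (All; []; _∷_)
open import Data.List.Relation.Unary.Any as Any using (Any; here; there)
import Data.List.Relation.Unary.Any.Properties as AnyP
open import Data.List.Relation.Unary.Unique.Propositional using (Unique; []; _∷_)
import Data.List.Relation.Unary.Unique.Propositional.Properties as UniqueP
open import Data.List.Relation.Unary.Unique.DecPropositional.Properties Data.Nat._≟_ using (deduplicate-!)
open import Data.Nat as ℕ using (zero; suc; _+_; _<_; _<?_; _≟_; s≤s)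
import Data.Nat.Properties as ℕP
import Data.Nat.Tactic.RingSolver as ℕSolver
open import Data.Product using (∃; ∃₂; _,_; proj₁; proj₂)
open import Data.Rational as ℚ using (ℚ)
import Data.Vec as V
import Data.Vec.Properties as VP
import Data.Vec.Membership.Propositional.Properties as VMP
open import Function using (_∘_)
open import Function.Bundles using (mk⇔)
open import Relation.Binary.Definitions using (tri<; tri≈; tri>)
open import Relation.Binary.PropositionalEquality
  using (_≡_; _≢_; refl; sym; trans; cong; cong₂; subst; subst₂; setoid; module ≡-Reasoning)
open import Relation.Nullary using (Dec; yes; no; ¬_)
open import Relation.Nullary.Decidable using (⌊_⌋; toWitness)
open import Relation.Unary using (Decidable)

module _ {A : Set} {P : A → Set} (P? : Decidable P) where

  count-accept : ∀ {x} xs → P x → count P? (x ∷ xs) ≡ suc (count P? xs)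
  count-accept xs px = cong length (LP.filter-accept P? px)

  count-reject : ∀ {x} xs → ¬ P x → count P? (x ∷ xs) ≡ count P? xs
  count-reject xs ¬px = cong length (LP.filter-reject P? ¬px)

  count-++ : ∀ xs ys → count P? (xs ++ ys) ≡ count P? xs + count P? ys
  count-++ xs ys = trans (cong length (LP.filter-++ P? xs ys)) (LP.length-++ (filter P? xs))

  count-↭ : ∀ {xs ys} → xs ↭ ys → count P? xs ≡ count P? ys
  count-↭ p = PermP.↭-length (PermP.filter-↭ P? p)

  count≡suc⇒Any : ∀ {xs n} → count P? xs ≡ suc n → Any P xs
  count≡suc⇒Any {x ∷ xs} eq with P? x
  ... | yes px = here px
  ... | no _   = there (count≡suc⇒Any eq)

  filter-accept₂ : ∀ {x y} a b c → P x → P y →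
    filter P? (a ++ x ∷ b ++ y ∷ c) ≡ filter P? a ++ x ∷ filter P? b ++ y ∷ filter P? c
  filter-accept₂ a b c px py = begin
    filter P? (a ++ _ ∷ b ++ _ ∷ c)                ≡⟨ LP.filter-++ P? a _ ⟩
    filter P? a ++ filter P? (_ ∷ b ++ _ ∷ c)      ≡⟨ cong (filter P? a ++_) (LP.filter-accept P? px) ⟩
    filter P? a ++ _ ∷ filter P? (b ++ _ ∷ c)      ≡⟨ cong (λ l → filter P? a ++ _ ∷ l) (LP.filter-++ P? b _) ⟩
    filter P? a ++ _ ∷ filter P? b ++ filter P? (_ ∷ c)
      ≡⟨ cong (λ l → filter P? a ++ _ ∷ filter P? b ++ l) (LP.filter-accept P? py) ⟩
    filter P? a ++ _ ∷ filter P? b ++ _ ∷ filter P? c ∎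
    where open ≡-Reasoning

  filter-reject₂ : ∀ {x y} a b c → ¬ P x → ¬ P y →
    filter P? (a ++ x ∷ b ++ y ∷ c) ≡ filter P? a ++ filter P? b ++ filter P? c
  filter-reject₂ a b c ¬px ¬py = begin
    filter P? (a ++ _ ∷ b ++ _ ∷ c)                ≡⟨ LP.filter-++ P? a _ ⟩
    filter P? a ++ filter P? (_ ∷ b ++ _ ∷ c)      ≡⟨ cong (filter P? a ++_) (LP.filter-reject P? ¬px) ⟩
    filter P? a ++ filter P? (b ++ _ ∷ c)          ≡⟨ cong (filter P? a ++_) (LP.filter-++ P? b _) ⟩
    filter P? a ++ filter P? b ++ filter P? (_ ∷ c)
      ≡⟨ cong (λ l → filter P? a ++ filter P? b ++ l) (LP.filter-reject P? ¬py) ⟩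
    filter P? a ++ filter P? b ++ filter P? c ∎
    where open ≡-Reasoning

foldr-↭ : ∀ {A : Set} {_∙_ : A → A → A} {ε : A} → IsCommutativeMonoid _≡_ _∙_ ε →
          ∀ {xs ys} → xs ↭ ys → foldr _∙_ ε xs ≡ foldr _∙_ ε ys
foldr-↭ {A} isCM p = foldr-commMonoid (setoid A) isCM (↭⇒↭ₛ p)

sumℕ-↭ : ∀ {xs ys} → xs ↭ ys → sumℕ xs ≡ sumℕ ys
sumℕ-↭ = foldr-↭ ℕP.+-0-isCommutativeMonoid

prodℤ-↭ : ∀ {xs ys} → xs ↭ ys → prodℤ xs ≡ prodℤ ys
prodℤ-↭ = foldr-↭ ℤP.*-1-isCommutativeMonoid

sumℤ-↭ : ∀ {xs ys} → xs ↭ ys → sumℤ xs ≡ sumℤ ys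
sumℤ-↭ = foldr-↭ ℤP.+-0-isCommutativeMonoid

sumℚ-↭ : ∀ {xs ys} → xs ↭ ys → sumℚ xs ≡ sumℚ ys
sumℚ-↭ = foldr-↭ ℚP.+-0-isCommutativeMonoid

sumℤ-map-neg : ∀ {B : Set} (f : B → ℤ) xs → sumℤ (map (ℤ.-_ ∘ f) xs) ≡ ℤ.- sumℤ (map f xs)
sumℤ-map-neg f []       = refl
sumℤ-map-neg f (x ∷ xs) = trans (cong (ℤ._+_ (ℤ.- f x)) (sumℤ-map-neg f xs)) (sym (ℤP.neg-distrib-+ (f x) _))

sumℚ-map-neg : ∀ {B : Set} (f : B → ℚ) xs → sumℚ (map (ℚ.-_ ∘ f) xs) ≡ ℚ.- sumℚ (map f xs)
sumℚ-map-neg f []       = refl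
sumℚ-map-neg f (x ∷ xs) = trans (cong (ℚ._+_ (ℚ.- f x)) (sumℚ-map-neg f xs)) (sym (ℚP.neg-distrib-+ (f x) _))

prodℤ-map-neg-at : ∀ {A : Set} (f g : A → ℤ) {e} {xs} → Unique xs → e ∈ xs →
  g e ≡ ℤ.- f e → (∀ x → x ≢ e → g x ≡ f x) → prodℤ (map g xs) ≡ ℤ.- prodℤ (map f xs)
prodℤ-map-neg-at f g (x∉ ∷ _) (here refl) neg agree =
  trans (cong₂ ℤ._*_ neg (cong prodℤ (LP.map-cong-local (All.map (λ x≢y → agree _ (x≢y ∘ sym)) x∉))))
        (sym (ℤP.neg-distribˡ-* (f _) _))
prodℤ-map-neg-at f g (x∉ ∷ u) (there e∈) neg agree =
  trans (cong₂ ℤ._*_ (agree _ (All.lookup x∉ e∈)) (prodℤ-map-neg-at f g u e∈ neg agree))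
        (sym (ℤP.neg-distribʳ-* (f _) _))

module _ {A : Set} where

  exchange-↭ : ∀ a (x : A) b y c → a ++ x ∷ b ++ y ∷ c ↭ a ++ y ∷ b ++ x ∷ c
  exchange-↭ a x b y c = PermP.++⁺ˡ a (begin
    x ∷ b ++ y ∷ c  ↭⟨ prep x (PermP.shift y b c) ⟩
    x ∷ y ∷ b ++ c  ↭⟨ swap x y ↭-refl ⟩
    y ∷ x ∷ b ++ c  ↭⟨ prep y (↭-sym (PermP.shift x b c)) ⟩
    y ∷ b ++ x ∷ c  ∎)
    where open PermutationReasoning

  ∈⇒↭∷ : ∀ {z : A} {xs} → z ∈ xs → ∃ λ rest → xs ↭ z ∷ rest
  ∈⇒↭∷ z∈xs with ys , zs , refl ← MP.∈-∃++ z∈xs = ys ++ zs , PermP.shift _ ys zs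

  repeated-↭ : ∀ {z : A} {u v} → z ∈ u → z ∈ v → ∃ λ rest → u ++ v ↭ z ∷ z ∷ rest
  repeated-↭ {z} z∈u z∈v with u′ , u↭ ← ∈⇒↭∷ z∈u | v′ , v↭ ← ∈⇒↭∷ z∈v =
    u′ ++ v′ , ↭-trans (PermP.++⁺ u↭ v↭) (prep z (PermP.shift z u′ v′))

allB-cong : ∀ {A : Set} {p q : A → Bool} → (∀ x → p x ≡ q x) → ∀ xs → allB p xs ≡ allB q xs
allB-cong p≗q []       = refl
allB-cong p≗q (x ∷ xs) = cong₂ (λ b r → if b then r else false) (p≗q x) (allB-cong p≗q xs)

allB⇒All : ∀ {A : Set} {p : A → Bool} xs → allB p xs ≡ true → All (λ x → p x ≡ true) xs
allB⇒All []                 _  = []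
allB⇒All {p = p} (x ∷ xs) h  with p x in px
allB⇒All         (x ∷ xs) h  | true = px ∷ allB⇒All xs h
allB⇒All         (x ∷ xs) () | false

isPermWord-↭ : ∀ {xs ys} → xs ↭ ys → isPermWord xs ≡ isPermWord ys
isPermWord-↭ {xs} {ys} p =
  trans (cong (allB (onceIn xs) ∘ upTo) (PermP.↭-length p))
        (allB-cong (λ v → cong (λ c → ⌊ c ≟ 1 ⌋) (count-↭ (_≟ suc v) p)) (upTo (length ys)))
  where
  onceIn : List ℕ → ℕ → Bool
  onceIn w v = ⌊ count (_≟ suc v) w ≟ 1 ⌋

isPermWord⇒count≡1 : ∀ {w} → isPermWord w ≡ true → ∀ {v} → v < length w → count (_≟ suc v) w ≡ 1
isPermWord⇒count≡1 {w} h v<k =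
  toWitness (subst T (sym (All.lookup (allB⇒All (upTo (length w)) h) (MP.∈-upTo⁺ v<k))) _)

-- Pigeonhole: the k letters 1..k, each occurring once, would all fit into the k - 2 letters of w.
isPermWord-outOfRange-repeat : ∀ {z w} → isPermWord (z ∷ z ∷ w) ≡ true →
  (∀ v → v < length (z ∷ z ∷ w) → z ≢ suc v) → ⊥
isPermWord-outOfRange-repeat {z} {w} h out =
  let i , i′ , i<i′ , same = FP.pigeonhole (ℕP.m<n⇒m<1+n (ℕP.n<1+n _)) position
  in  ℕP.<-irrefl (ℕP.suc-injective (letters-equal same)) i<i′
  where
  occurs : (i : Fin (length (z ∷ z ∷ w))) → Any (_≡ suc (F.toℕ i)) w
  occurs i = count≡suc⇒Any (_≟ suc (F.toℕ i)) {w} (trans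
    (sym (trans (count-reject (_≟ suc (F.toℕ i)) (z ∷ w) z≢) (count-reject (_≟ suc (F.toℕ i)) w z≢)))
    (isPermWord⇒count≡1 {z ∷ z ∷ w} h (FP.toℕ<n i)))
    where z≢ = out (F.toℕ i) (FP.toℕ<n i)
  position : Fin (length (z ∷ z ∷ w)) → Fin (length w)
  position i = Any.index (occurs i)
  letters-equal : ∀ {i i′} → position i ≡ position i′ → suc (F.toℕ i) ≡ suc (F.toℕ i′)
  letters-equal {i} {i′} same = trans (sym (AnyP.lookup-index (occurs i)))
    (trans (cong (L.lookup w) same) (AnyP.lookup-index (occurs i′)))

isPermWord-repeat : ∀ z w → isPermWord (z ∷ z ∷ w) ≢ true
isPermWord-repeat zero    w h = isPermWord-outOfRange-repeat {zero} {w} h (λ _ _ ())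
isPermWord-repeat (suc v) w h with v <? length (suc v ∷ suc v ∷ w)
... | yes v<k = twice≢once (isPermWord⇒count≡1 {suc v ∷ suc v ∷ w} h v<k)
  where
  twice≢once : count (_≟ suc v) (suc v ∷ suc v ∷ w) ≢ 1
  twice≢once once with () ← trans (sym once)
    (trans (count-accept (_≟ suc v) (suc v ∷ w) refl) (cong suc (count-accept (_≟ suc v) w refl)))
... | no v≮k = isPermWord-outOfRange-repeat {suc v} {w} h
  (λ v′ v′<k sv≡sv′ → v≮k (subst (_< _) (sym (ℕP.suc-injective sv≡sv′)) v′<k))

sgn-repeat : ∀ {w z rest} → w ↭ z ∷ z ∷ rest → sgn w ≡ + 0
sgn-repeat {w} {z} {rest} p with isPermWord w in perm
... | true  = ⊥-elim (isPermWord-repeat z rest (trans (sym (isPermWord-↭ p)) perm))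
... | false = refl

-- Inversions and signs of words

countBelow countAbove : ℕ → List ℕ → ℕ
countBelow x = count (_<? x)
countAbove x = count (x <?_)

crossInv : List ℕ → List ℕ → ℕ
crossInv u v = sumℕ (map (λ z → countBelow z v) u)

inv-++ : ∀ u v → inv (u ++ v) ≡ inv u + crossInv u v + inv v
inv-++ []      v = refl
inv-++ (z ∷ u) v = begin
  countBelow z (u ++ v) + inv (u ++ v)
    ≡⟨ cong₂ _+_ (count-++ (_<? z) u v) (inv-++ u v) ⟩
  (countBelow z u + countBelow z v) + (inv u + crossInv u v + inv v)
    ≡⟨ rearrange (countBelow z u) (countBelow z v) (inv u) (crossInv u v) (inv v) ⟩
  (countBelow z u + inv u) + (countBelow z v + crossInv u v) + inv v ∎
  where
  open ≡-Reasoning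
  rearrange : ∀ a b c d e → (a + b) + (c + d + e) ≡ (a + c) + (b + d) + e
  rearrange = ℕSolver.solve-∀

crossInv-↭ˡ : ∀ {u u′} v → u ↭ u′ → crossInv u v ≡ crossInv u′ v
crossInv-↭ˡ v p = sumℕ-↭ (PermP.map⁺ _ p)

crossInv-↭ʳ : ∀ u {v v′} → v ↭ v′ → crossInv u v ≡ crossInv u v′
crossInv-↭ʳ u p = cong sumℕ (LP.map-cong (λ z → count-↭ (_<? z) p) u)

crossInv-[] : ∀ b y → crossInv b [ y ] ≡ countAbove y b
crossInv-[] []      y = refl
crossInv-[] (z ∷ b) y with y <? z
... | yes y<z = begin
  countBelow z [ y ] + crossInv b [ y ] ≡⟨ cong₂ _+_ (count-accept (_<? z) [] y<z) (crossInv-[] b y) ⟩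
  suc (countAbove y b)                  ≡⟨ count-accept (y <?_) b y<z ⟨
  countAbove y (z ∷ b)                  ∎
  where open ≡-Reasoning
... | no y≮z = begin
  countBelow z [ y ] + crossInv b [ y ] ≡⟨ cong₂ _+_ (count-reject (_<? z) [] y≮z) (crossInv-[] b y) ⟩
  countAbove y b                        ≡⟨ count-reject (y <?_) b y≮z ⟨
  countAbove y (z ∷ b)                  ∎
  where open ≡-Reasoning

countBelow+countAbove : ∀ x b → x ∉ b → countBelow x b + countAbove x b ≡ length b
countBelow+countAbove x []      _   = refl
countBelow+countAbove x (z ∷ b) x∉ with ℕP.<-cmp z x
... | tri< z<x _ x≮z = begin
  countBelow x (z ∷ b) + countAbove x (z ∷ b)
    ≡⟨ cong₂ _+_ (count-accept (_<? x) b z<x) (count-reject (x <?_) b x≮z) ⟩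
  suc (countBelow x b + countAbove x b) ≡⟨ cong suc (countBelow+countAbove x b (x∉ ∘ there)) ⟩
  suc (length b) ∎
  where open ≡-Reasoning
... | tri≈ _ z≡x _ = ⊥-elim (x∉ (here (sym z≡x)))
... | tri> z≮x _ x<z = begin
  countBelow x (z ∷ b) + countAbove x (z ∷ b)
    ≡⟨ cong₂ _+_ (count-reject (_<? x) b z≮x) (count-accept (x <?_) b x<z) ⟩
  countBelow x b + suc (countAbove x b) ≡⟨ ℕP.+-suc _ _ ⟩
  suc (countBelow x b + countAbove x b) ≡⟨ cong suc (countBelow+countAbove x b (x∉ ∘ there)) ⟩
  suc (length b) ∎
  where open ≡-Reasoning

countBelow-pair : ∀ {x y} → x ≢ y → countBelow x [ y ] + countBelow y [ x ] ≡ 1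
countBelow-pair {x} {y} x≢y with ℕP.<-cmp x y
... | tri< x<y _ y≮x = cong₂ _+_ (count-reject (_<? x) [] y≮x) (count-accept (_<? y) [] x<y)
... | tri≈ _ x≡y _   = ⊥-elim (x≢y x≡y)
... | tri> x≮y _ y<x = cong₂ _+_ (count-accept (_<? x) [] y<x) (count-reject (_<? y) [] x≮y)

inv-endpoints : ∀ x b y →
  inv (x ∷ b ++ [ y ]) ≡ (countBelow x b + countBelow x [ y ]) + (inv b + countAbove y b + 0)
inv-endpoints x b y = cong₂ _+_ (count-++ (_<? x) b [ y ])
  (trans (inv-++ b [ y ]) (cong (λ c → inv b + c + 0) (crossInv-[] b y)))

-- Across the two words, each letter of b makes exactly two inversions with x and y, and x, y make one.
inv-exchangeEnds : ∀ {x y} b → x ≢ y → x ∉ b → y ∉ b →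
  inv (x ∷ b ++ [ y ]) + inv (y ∷ b ++ [ x ]) ≡ suc ((length b + inv b) + (length b + inv b))
inv-exchangeEnds {x} {y} b x≢y x∉b y∉b = begin
  inv (x ∷ b ++ [ y ]) + inv (y ∷ b ++ [ x ])
    ≡⟨ cong₂ _+_ (inv-endpoints x b y) (inv-endpoints y b x) ⟩
  (countBelow x b + countBelow x [ y ]) + (inv b + countAbove y b + 0)
    + ((countBelow y b + countBelow y [ x ]) + (inv b + countAbove x b + 0))
    ≡⟨ regroup (countBelow x b) (countBelow x [ y ]) (inv b) (countAbove y b)
               (countBelow y b) (countBelow y [ x ]) (countAbove x b) ⟩
  (countBelow x b + countAbove x b) + (countBelow y b + countAbove y b)
    + (countBelow x [ y ] + countBelow y [ x ]) + (inv b + inv b)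
    ≡⟨ cong₂ (λ s t → s + t + (inv b + inv b))
         (cong₂ _+_ (countBelow+countAbove x b x∉b) (countBelow+countAbove y b y∉b))
         (countBelow-pair x≢y) ⟩
  length b + length b + 1 + (inv b + inv b)
    ≡⟨ collect (length b) (inv b) ⟩
  suc ((length b + inv b) + (length b + inv b)) ∎
  where
  open ≡-Reasoning
  regroup : ∀ a b c d e f g →
    (a + b) + (c + d + 0) + ((e + f) + (c + g + 0)) ≡ (a + g) + (e + d) + (b + f) + (c + c)
  regroup = ℕSolver.solve-∀
  collect : ∀ l i → l + l + 1 + (i + i) ≡ suc ((l + i) + (l + i))
  collect = ℕSolver.solve-∀

negOnePow-suc : ∀ k → negOnePow (suc k) ≡ ℤ.- negOnePow k
negOnePow-suc zero          = refl
negOnePow-suc (suc zero)    = refl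
negOnePow-suc (suc (suc k)) = negOnePow-suc k

negOnePow-+ : ∀ k l → negOnePow (k + l) ≡ negOnePow k ℤ.* negOnePow l
negOnePow-+ zero    l = sym (ℤP.*-identityˡ (negOnePow l))
negOnePow-+ (suc k) l = begin
  negOnePow (suc (k + l))                   ≡⟨ negOnePow-suc (k + l) ⟩
  ℤ.- negOnePow (k + l)                     ≡⟨ cong ℤ.-_ (negOnePow-+ k l) ⟩
  ℤ.- (negOnePow k ℤ.* negOnePow l)         ≡⟨ ℤP.neg-distribˡ-* (negOnePow k) (negOnePow l) ⟩
  (ℤ.- negOnePow k) ℤ.* negOnePow l         ≡⟨ cong (ℤ._* negOnePow l) (negOnePow-suc k) ⟨
  negOnePow (suc k) ℤ.* negOnePow l         ∎
  where open ≡-Reasoning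

negOnePow-square : ∀ k → negOnePow k ℤ.* negOnePow k ≡ + 1
negOnePow-square zero          = refl
negOnePow-square (suc zero)    = refl
negOnePow-square (suc (suc k)) = negOnePow-square k

negOnePow-oddSum : ∀ k l r → k + l ≡ suc (r + r) → negOnePow l ≡ ℤ.- negOnePow k
negOnePow-oddSum k l r odd = begin
  negOnePow l                                      ≡⟨ ℤP.*-identityˡ (negOnePow l) ⟨
  + 1 ℤ.* negOnePow l                              ≡⟨ cong (ℤ._* negOnePow l) (negOnePow-square k) ⟨
  negOnePow k ℤ.* negOnePow k ℤ.* negOnePow l      ≡⟨ ℤP.*-assoc (negOnePow k) (negOnePow k) (negOnePow l) ⟩
  negOnePow k ℤ.* (negOnePow k ℤ.* negOnePow l)    ≡⟨ cong (negOnePow k ℤ.*_) product ⟩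
  negOnePow k ℤ.* ℤ.-1ℤ                            ≡⟨ ℤP.*-comm (negOnePow k) ℤ.-1ℤ ⟩
  ℤ.-1ℤ ℤ.* negOnePow k                            ≡⟨ ℤP.-1*i≡-i (negOnePow k) ⟩
  ℤ.- negOnePow k                                  ∎
  where
  open ≡-Reasoning
  product : negOnePow k ℤ.* negOnePow l ≡ ℤ.-1ℤ
  product = begin
    negOnePow k ℤ.* negOnePow l       ≡⟨ negOnePow-+ k l ⟨
    negOnePow (k + l)                 ≡⟨ cong negOnePow odd ⟩
    negOnePow (suc (r + r))           ≡⟨ negOnePow-suc (r + r) ⟩
    ℤ.- negOnePow (r + r)             ≡⟨ cong ℤ.-_ (negOnePow-+ r r) ⟩
    ℤ.- (negOnePow r ℤ.* negOnePow r) ≡⟨ cong ℤ.-_ (negOnePow-square r) ⟩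
    ℤ.-1ℤ                             ∎

negOnePow-odd : ∀ d → Odd d → negOnePow d ≡ ℤ.-1ℤ
negOnePow-odd (suc zero)    _   = refl
negOnePow-odd (suc (suc d)) odd = negOnePow-odd d odd

negOnePow-even : ∀ d → Even d → negOnePow d ≡ + 1
negOnePow-even zero          _    = refl
negOnePow-even (suc (suc d)) even = negOnePow-even d even

signWord-++ : ∀ u v → signWord (u ++ v) ≡ signWord u ℤ.* negOnePow (crossInv u v) ℤ.* signWord v
signWord-++ u v = begin
  negOnePow (inv (u ++ v))                                  ≡⟨ cong negOnePow (inv-++ u v) ⟩
  negOnePow (inv u + crossInv u v + inv v)                  ≡⟨ negOnePow-+ (inv u + crossInv u v) (inv v) ⟩
  negOnePow (inv u + crossInv u v) ℤ.* signWord v           ≡⟨ cong (ℤ._* signWord v) (negOnePow-+ (inv u) _) ⟩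
  signWord u ℤ.* negOnePow (crossInv u v) ℤ.* signWord v    ∎
  where open ≡-Reasoning

signWord-++-negˡ : ∀ {u u′} v → u′ ↭ u → signWord u′ ≡ ℤ.- signWord u →
  signWord (u′ ++ v) ≡ ℤ.- signWord (u ++ v)
signWord-++-negˡ {u} {u′} v u′↭u neg = begin
  signWord (u′ ++ v)                                           ≡⟨ signWord-++ u′ v ⟩
  signWord u′ ℤ.* negOnePow (crossInv u′ v) ℤ.* signWord v
    ≡⟨ cong₂ (λ s c → s ℤ.* negOnePow c ℤ.* signWord v) neg (crossInv-↭ˡ v u′↭u) ⟩
  (ℤ.- signWord u) ℤ.* negOnePow (crossInv u v) ℤ.* signWord v  ≡⟨ negate-first (signWord u) (negOnePow (crossInv u v)) (signWord v) ⟩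
  ℤ.- (signWord u ℤ.* negOnePow (crossInv u v) ℤ.* signWord v)  ≡⟨ cong ℤ.-_ (signWord-++ u v) ⟨
  ℤ.- signWord (u ++ v)                                         ∎
  where
  open ≡-Reasoning
  negate-first : ∀ a b c → (ℤ.- a) ℤ.* b ℤ.* c ≡ ℤ.- (a ℤ.* b ℤ.* c)
  negate-first = ℤSolver.solve-∀

signWord-++-negʳ : ∀ u {v v′} → v′ ↭ v → signWord v′ ≡ ℤ.- signWord v →
  signWord (u ++ v′) ≡ ℤ.- signWord (u ++ v)
signWord-++-negʳ u {v} {v′} v′↭v neg = begin
  signWord (u ++ v′)                                           ≡⟨ signWord-++ u v′ ⟩
  signWord u ℤ.* negOnePow (crossInv u v′) ℤ.* signWord v′
    ≡⟨ cong₂ (λ c s → signWord u ℤ.* negOnePow c ℤ.* s) (crossInv-↭ʳ u v′↭v) neg ⟩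
  signWord u ℤ.* negOnePow (crossInv u v) ℤ.* (ℤ.- signWord v)  ≡⟨ ℤP.neg-distribʳ-* (signWord u ℤ.* negOnePow (crossInv u v)) (signWord v) ⟨
  ℤ.- (signWord u ℤ.* negOnePow (crossInv u v) ℤ.* signWord v)  ≡⟨ cong ℤ.-_ (signWord-++ u v) ⟨
  ℤ.- signWord (u ++ v)                                         ∎
  where open ≡-Reasoning

signWord-exchange : ∀ a {x} b {y} c → x ≢ y → x ∉ b → y ∉ b →
  signWord (a ++ y ∷ b ++ x ∷ c) ≡ ℤ.- signWord (a ++ x ∷ b ++ y ∷ c)
signWord-exchange a {x} b {y} c x≢y x∉b y∉b =
  subst₂ (λ w′ w → signWord w′ ≡ ℤ.- signWord w) (around y x) (around x y)
    (signWord-++-negʳ a (PermP.++⁺ʳ c (exchange-↭ [] y b x []))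
      (signWord-++-negˡ c (exchange-↭ [] y b x [])
        (negOnePow-oddSum (inv (x ∷ b ++ [ y ])) (inv (y ∷ b ++ [ x ])) (length b + inv b)
          (inv-exchangeEnds b x≢y x∉b y∉b))))
  where
  around : ∀ s t → a ++ (s ∷ b ++ [ t ]) ++ c ≡ a ++ s ∷ b ++ t ∷ c
  around s t = cong (λ r → a ++ s ∷ r) (LP.++-assoc b [ t ] c)

sgn-exchange-repeated : ∀ a x b y c {z} u v → u ++ v ≡ a ++ x ∷ b ++ y ∷ c → z ∈ u → z ∈ v →
  sgn (a ++ y ∷ b ++ x ∷ c) ≡ ℤ.- sgn (a ++ x ∷ b ++ y ∷ c)
sgn-exchange-repeated a x b y c {z} u v split z∈u z∈v with rest , uv↭ ← repeated-↭ z∈u z∈v =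
  let w↭ = subst (_↭ z ∷ z ∷ rest) split uv↭
  in  trans (sgn-repeat (↭-trans (exchange-↭ a y b x c) w↭)) (cong ℤ.-_ (sym (sgn-repeat w↭)))

sgn-exchange : ∀ a x b y c → sgn (a ++ y ∷ b ++ x ∷ c) ≡ ℤ.- sgn (a ++ x ∷ b ++ y ∷ c)
sgn-exchange a x b y c with x ≟ y | x ∈? b | y ∈? b
... | yes refl | _ | _ = sgn-exchange-repeated a x b y c (a ++ [ x ]) (b ++ x ∷ c)
  (LP.++-assoc a [ x ] _) (MP.∈-++⁺ʳ a (here refl)) (MP.∈-++⁺ʳ b (here refl))
... | no _ | yes x∈b | _ = sgn-exchange-repeated a x b y c (a ++ [ x ]) (b ++ y ∷ c)
  (LP.++-assoc a [ x ] _) (MP.∈-++⁺ʳ a (here refl)) (MP.∈-++⁺ˡ x∈b)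
... | no _ | no _ | yes y∈b = sgn-exchange-repeated a x b y c (a ++ x ∷ b) (y ∷ c)
  (LP.++-assoc a (x ∷ b) _) (MP.∈-++⁺ʳ a (there y∈b)) (here refl)
... | no x≢y | no x∉b | no y∉b with isPermWord (a ++ x ∷ b ++ y ∷ c) in perm
...   | true  rewrite isPermWord-↭ (exchange-↭ a y b x c) | perm = signWord-exchange a b c x≢y x∉b y∉b
...   | false rewrite isPermWord-↭ (exchange-↭ a y b x c) | perm = refl

module _ {m : ℕ} where

  transpose-matchˡ : (i j : Fin m) → transpose i j i ≡ j
  transpose-matchˡ i j with i FP.≟ i
  ... | yes _   = refl
  ... | no i≢i  = ⊥-elim (i≢i refl)

  transpose-matchʳ : (i j : Fin m) → transpose i j j ≡ i
  transpose-matchʳ i j with j FP.≟ i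
  ... | yes j≡i = j≡i
  ... | no _ with j FP.≟ j
  ...   | yes _   = refl
  ...   | no j≢j  = ⊥-elim (j≢j refl)

  transpose-other : ∀ {i j k : Fin m} → k ≢ i → k ≢ j → transpose i j k ≡ k
  transpose-other {i} {j} {k} k≢i k≢j with k FP.≟ i
  ... | yes k≡i = ⊥-elim (k≢i k≡i)
  ... | no _ with k FP.≟ j
  ...   | yes k≡j = ⊥-elim (k≢j k≡j)
  ...   | no _    = refl

  transpose-involutive : (i j k : Fin m) → transpose i j (transpose i j k) ≡ k
  transpose-involutive i j k with k FP.≟ i
  ... | yes refl = transpose-matchʳ k j
  ... | no k≢i with k FP.≟ j
  ...   | yes refl = transpose-matchˡ i k
  ...   | no k≢j   = transpose-other k≢i k≢j

  transpose-preserves : ∀ {A : Set} (h : Fin m → A) {i j} → h i ≡ h j → ∀ k → h (transpose i j k) ≡ h k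
  transpose-preserves h {i} {j} hi≡hj k = by-cases (k FP.≟ i) (k FP.≟ j)
    where
    by-cases : Dec (k ≡ i) → Dec (k ≡ j) → h (transpose i j k) ≡ h k
    by-cases (yes refl) _          = trans (cong h (transpose-matchˡ k j)) (sym hi≡hj)
    by-cases (no _)     (yes refl) = trans (cong h (transpose-matchʳ i k)) hi≡hj
    by-cases (no k≢i)   (no k≢j)   = cong h (transpose-other k≢i k≢j)

record Exchange {A : Set} (xs ys : List A) (x y : A) : Set where
  field
    before between after : List A
    xs≡ : xs ≡ before ++ x ∷ between ++ y ∷ after
    ys≡ : ys ≡ before ++ y ∷ between ++ x ∷ after

Exchange⇒↭ : ∀ {A : Set} {xs ys : List A} {x y} → Exchange xs ys x y → ys ↭ xs
Exchange⇒↭ e = subst₂ _↭_ (sym ys≡) (sym xs≡) (exchange-↭ before _ between _ after)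
  where open Exchange e

sgn-Exchange : ∀ {w w′ x y} → Exchange w w′ x y → sgn w′ ≡ ℤ.- sgn w
sgn-Exchange e = subst₂ (λ v′ v → sgn v′ ≡ ℤ.- sgn v) (sym ys≡) (sym xs≡) (sgn-exchange before _ between _ after)
  where open Exchange e

module _ {A : Set} where

  tabulate-agreeOff : ∀ {m} (k : Fin m) (h h′ : Fin m → A) → (∀ i → i ≢ k → h′ i ≡ h i) →
    ∃₂ λ b c → tabulate h ≡ b ++ h k ∷ c × tabulate h′ ≡ b ++ h′ k ∷ c
  tabulate-agreeOff F.zero    h h′ agree =
    [] , tabulate (h ∘ F.suc) , refl , cong (h′ F.zero ∷_) (LP.tabulate-cong (λ i → agree (F.suc i) λ ()))
  tabulate-agreeOff (F.suc k) h h′ agree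
    with b , c , eq , eq′ ← tabulate-agreeOff k (h ∘ F.suc) (h′ ∘ F.suc) (λ i i≢k → agree (F.suc i) (i≢k ∘ FP.suc-injective))
    = h F.zero ∷ b , c , cong (h F.zero ∷_) eq , cong₂ _∷_ (agree F.zero λ ()) eq′

  tabulate-agreeOff₂ : ∀ {m} {j k : Fin m} → F.toℕ j < F.toℕ k → (h h′ : Fin m → A) →
    (∀ i → i ≢ j → i ≢ k → h′ i ≡ h i) →
    ∃ λ a → ∃₂ λ b c → tabulate h ≡ a ++ h j ∷ b ++ h k ∷ c × tabulate h′ ≡ a ++ h′ j ∷ b ++ h′ k ∷ c
  tabulate-agreeOff₂ {j = F.zero} {F.suc k} _ h h′ agree
    with b , c , eq , eq′ ← tabulate-agreeOff k (h ∘ F.suc) (h′ ∘ F.suc) (λ i i≢k → agree (F.suc i) (λ ()) (i≢k ∘ FP.suc-injective))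
    = [] , b , c , cong (h F.zero ∷_) eq , cong (h′ F.zero ∷_) eq′
  tabulate-agreeOff₂ {j = F.suc j} {F.suc k} (s≤s j<k) h h′ agree
    with a , b , c , eq , eq′ ← tabulate-agreeOff₂ j<k (h ∘ F.suc) (h′ ∘ F.suc)
           (λ i i≢j i≢k → agree (F.suc i) (i≢j ∘ FP.suc-injective) (i≢k ∘ FP.suc-injective))
    = h F.zero ∷ a , b , c , cong (h F.zero ∷_) eq , cong₂ _∷_ (agree F.zero (λ ()) (λ ())) eq′

  tabulate-transpose : ∀ {m} {j k : Fin m} → F.toℕ j < F.toℕ k → (h : Fin m → A) →
    Exchange (tabulate h) (tabulate (h ∘ transpose j k)) (h j) (h k)
  tabulate-transpose {j = j} {k} j<k h
    with a , b , c , eq , eq′ ← tabulate-agreeOff₂ j<k h (h ∘ transpose j k)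
           (λ i i≢j i≢k → cong h (transpose-other i≢j i≢k))
    = record
      { before = a ; between = b ; after = c ; xs≡ = eq
      ; ys≡ = trans eq′ (cong₂ (λ u v → a ++ u ∷ b ++ v ∷ c)
                               (cong h (transpose-matchˡ j k)) (cong h (transpose-matchʳ j k))) }

-- Exchanging two columns of a table

module _ {A : Set} {m : ℕ} where

  swapEntries : Fin m → Fin m → Vec A m → Vec A m
  swapEntries j k v = V.tabulate (V.lookup v ∘ transpose j k)

  lookup-swapEntries : ∀ j k (v : Vec A m) i → V.lookup (swapEntries j k v) i ≡ V.lookup v (transpose j k i)
  lookup-swapEntries j k v = VP.lookup∘tabulate (V.lookup v ∘ transpose j k)

  swapEntries-involutive : ∀ j k (v : Vec A m) → swapEntries j k (swapEntries j k v) ≡ v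
  swapEntries-involutive j k v = trans
    (VP.tabulate-cong (λ i → trans (lookup-swapEntries j k v (transpose j k i))
                                   (cong (V.lookup v) (transpose-involutive j k i))))
    (VP.tabulate∘lookup v)

toList-lookup : ∀ {A : Set} {m} (v : Vec A m) → V.toList v ≡ tabulate (V.lookup v)
toList-lookup V.[]       = refl
toList-lookup (x V.∷ v) = cong (x ∷_) (toList-lookup v)

finWord-tabulate : ∀ {n m} (v : Vec (Fin n) m) → finWord v ≡ tabulate (suc ∘ F.toℕ ∘ V.lookup v)
finWord-tabulate v = trans (cong (map (suc ∘ F.toℕ)) (toList-lookup v)) (LP.map-tabulate (V.lookup v) _)

zip-toList : ∀ {A B C : Set} {m} (s : Vec A m) (f : B → C) (x : Vec B m) →
  zip (V.toList s) (map f (V.toList x)) ≡ tabulate (λ i → V.lookup s i , f (V.lookup x i))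
zip-toList V.[]       f V.[]       = refl
zip-toList (a V.∷ s) f (b V.∷ x) = cong ((a , f b) ∷_) (zip-toList s f x)

sgnMap-swapEntries : ∀ {m} {j k : Fin m} → F.toℕ j < F.toℕ k → (σ : Vec (Fin m) m) →
  sgnMap (swapEntries j k σ) ≡ ℤ.- sgnMap σ
sgnMap-swapEntries {j = j} {k} j<k σ = begin
  sgn (finWord (swapEntries j k σ))  ≡⟨ cong sgn (trans (finWord-tabulate (swapEntries j k σ))
                                          (LP.tabulate-cong (cong (suc ∘ F.toℕ) ∘ lookup-swapEntries j k σ))) ⟩
  sgn (tabulate (g ∘ transpose j k)) ≡⟨ sgn-Exchange (tabulate-transpose j<k g) ⟩
  ℤ.- sgn (tabulate g)               ≡⟨ cong (ℤ.-_ ∘ sgn) (finWord-tabulate σ) ⟨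
  ℤ.- sgn (finWord σ)                ∎
  where
  open ≡-Reasoning
  g = suc ∘ F.toℕ ∘ V.lookup σ

-- sgnRel s x unfolds to prodℤ (map (letterSign (zip s x)) (deduplicate _≟_ s)).
letterSign : List (ℕ × ℕ) → ℕ → ℤ
letterSign ps c = sgn (map proj₂ (filter (λ p → proj₁ p ≟ c) ps))

letterSign-exchange : ∀ a b c {p q} → proj₁ p ≡ proj₁ q →
  letterSign (a ++ q ∷ b ++ p ∷ c) (proj₁ p) ≡ ℤ.- letterSign (a ++ p ∷ b ++ q ∷ c) (proj₁ p)
letterSign-exchange a b c {p} {q} same =
  subst₂ (λ w′ w → sgn w′ ≡ ℤ.- sgn w) (sym (project q p (sym same) refl)) (sym (project p q refl (sym same)))
    (sgn-exchange (proj₂-of a) (proj₂ p) (proj₂-of b) (proj₂ q) (proj₂-of c))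
  where
  P? = λ (r : ℕ × ℕ) → proj₁ r ≟ proj₁ p
  proj₂-of = map proj₂ ∘ filter P?
  project : ∀ r s → proj₁ r ≡ proj₁ p → proj₁ s ≡ proj₁ p →
    map proj₂ (filter P? (a ++ r ∷ b ++ s ∷ c)) ≡ proj₂-of a ++ proj₂ r ∷ proj₂-of b ++ proj₂ s ∷ proj₂-of c
  project r s r₁ s₁ = begin
    map proj₂ (filter P? (a ++ r ∷ b ++ s ∷ c))
      ≡⟨ cong (map proj₂) (filter-accept₂ P? a b c r₁ s₁) ⟩
    map proj₂ (filter P? a ++ r ∷ filter P? b ++ s ∷ filter P? c)
      ≡⟨ LP.map-++ proj₂ (filter P? a) _ ⟩
    proj₂-of a ++ proj₂ r ∷ map proj₂ (filter P? b ++ s ∷ filter P? c)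
      ≡⟨ cong (λ l → proj₂-of a ++ proj₂ r ∷ l) (LP.map-++ proj₂ (filter P? b) _) ⟩
    proj₂-of a ++ proj₂ r ∷ proj₂-of b ++ proj₂ s ∷ proj₂-of c ∎
    where open ≡-Reasoning

letterSign-exchange-other : ∀ a b c {p q} e → e ≢ proj₁ p → e ≢ proj₁ q →
  letterSign (a ++ q ∷ b ++ p ∷ c) e ≡ letterSign (a ++ p ∷ b ++ q ∷ c) e
letterSign-exchange-other a b c e e≢p e≢q = cong (sgn ∘ map proj₂)
  (trans (filter-reject₂ P? a b c (e≢q ∘ sym) (e≢p ∘ sym)) (sym (filter-reject₂ P? a b c (e≢p ∘ sym) (e≢q ∘ sym))))
  where P? = λ (r : ℕ × ℕ) → proj₁ r ≟ e

prodℤ-letterSign-Exchange : ∀ {ps ps′ p q} cs → Unique cs → proj₁ p ∈ cs → proj₁ p ≡ proj₁ q →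
  Exchange ps ps′ p q → prodℤ (map (letterSign ps′) cs) ≡ ℤ.- prodℤ (map (letterSign ps) cs)
prodℤ-letterSign-Exchange {p = p} {q} cs unique p∈cs same e =
  subst₂ (λ ps′ ps → prodℤ (map (letterSign ps′) cs) ≡ ℤ.- prodℤ (map (letterSign ps) cs)) (sym ys≡) (sym xs≡)
    (prodℤ-map-neg-at _ _ unique p∈cs (letterSign-exchange before between after same)
      (λ c c≢p → letterSign-exchange-other before between after c c≢p (λ c≡q → c≢p (trans c≡q (sym same)))))
  where open Exchange e

sgnRel-swapEntries : ∀ {m n} {j k : Fin m} → F.toℕ j < F.toℕ k → (t : Vec ℕ m) → V.lookup t j ≡ V.lookup t k →
  (x : Vec (Fin n) m) → sgnRel (V.toList t) (finWord (swapEntries j k x)) ≡ ℤ.- sgnRel (V.toList t) (finWord x)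
sgnRel-swapEntries {j = j} {k} j<k t tj≡tk x =
  subst₂ (λ ps′ ps → prodℤ (map (letterSign ps′) letters) ≡ ℤ.- prodℤ (map (letterSign ps) letters))
    (sym zip-swapped) (sym (zip-toList t (suc ∘ F.toℕ) x))
    (prodℤ-letterSign-Exchange letters (deduplicate-! (V.toList t))
      (MP.∈-deduplicate⁺ _≟_ (VMP.∈-toList⁺ (VMP.∈-lookup j t))) tj≡tk (tabulate-transpose j<k p))
  where
  letters = deduplicate _≟_ (V.toList t)
  p : Fin _ → ℕ × ℕ
  p i = V.lookup t i , suc (F.toℕ (V.lookup x i))
  zip-swapped : zip (V.toList t) (finWord (swapEntries j k x)) ≡ tabulate (p ∘ transpose j k)
  zip-swapped = trans (zip-toList t (suc ∘ F.toℕ) (swapEntries j k x)) (LP.tabulate-cong (λ i →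
    cong₂ _,_ (sym (transpose-preserves (V.lookup t) tj≡tk i)) (cong (suc ∘ F.toℕ) (lookup-swapEntries j k x i))))

swapColumns : ∀ {A : Set} {d m} → Fin m → Fin m → Table A d m → Table A d m
swapColumns j k = V.map (swapEntries j k)

sgnT-swapColumns : ∀ {n d m} {j k : Fin m} → F.toℕ j < F.toℕ k → (T : Table ℕ d m) → column T j ≡ column T k →
  (X : Table (Fin n) d m) → sgnT T (swapColumns j k X) ≡ negOnePow d ℤ.* sgnT T X
sgnT-swapColumns _ V.[] _ V.[] = refl
sgnT-swapColumns {d = suc d} {j = j} {k} j<k (t V.∷ T) same (x V.∷ X) = begin
  sgnRel (V.toList t) (finWord (swapEntries j k x)) ℤ.* sgnT T (swapColumns j k X)
    ≡⟨ cong₂ ℤ._*_ (sgnRel-swapEntries j<k t (VP.∷-injectiveˡ same) x)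
                   (sgnT-swapColumns j<k T (VP.∷-injectiveʳ same) X) ⟩
  (ℤ.- r) ℤ.* (negOnePow d ℤ.* sgnT T X)  ≡⟨ rearrange r (negOnePow d) (sgnT T X) ⟩
  (ℤ.- negOnePow d) ℤ.* (r ℤ.* sgnT T X)  ≡⟨ cong (ℤ._* (r ℤ.* sgnT T X)) (negOnePow-suc d) ⟨
  negOnePow (suc d) ℤ.* (r ℤ.* sgnT T X)  ∎
  where
  open ≡-Reasoning
  r = sgnRel (V.toList t) (finWord x)
  rearrange : ∀ a b c → (ℤ.- a) ℤ.* (b ℤ.* c) ≡ (ℤ.- b) ℤ.* (a ℤ.* c)
  rearrange = ℤSolver.solve-∀

column-swapColumns : ∀ {A : Set} {d m} (j k : Fin m) (X : Table A d m) i →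
  column (swapColumns j k X) i ≡ column X (transpose j k i)
column-swapColumns j k X i = trans (sym (VP.map-∘ (λ row → V.lookup row i) (swapEntries j k) X))
  (VP.map-cong (λ row → lookup-swapEntries j k row i) X)

matchProd-swapColumns : ∀ {n d m} {j k : Fin m} → F.toℕ j < F.toℕ k → (Y X : Table (Fin n) d m) (σ : Vec (Fin m) m) →
  matchProd Y (swapColumns j k X) σ ≡ matchProd Y X (swapEntries j k σ)
matchProd-swapColumns {j = j} {k} j<k Y X σ = begin
  prodℤ (tabulate (λ i → delta (finCols (swapColumns j k X) i) (finCols Y (V.lookup σ i))))
    ≡⟨ cong prodℤ (LP.tabulate-cong (λ i →
         cong₂ delta (cong (V.map (suc ∘ F.toℕ)) (column-swapColumns j k X i))
                     (cong (finCols Y ∘ V.lookup σ) (sym (transpose-involutive j k i))))) ⟩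
  prodℤ (tabulate (g ∘ transpose j k))  ≡⟨ prodℤ-↭ (Exchange⇒↭ (tabulate-transpose j<k g)) ⟩
  prodℤ (tabulate g)
    ≡⟨ cong prodℤ (LP.tabulate-cong (λ i →
         cong (delta (finCols X i) ∘ finCols Y) (sym (lookup-swapEntries j k σ i)))) ⟩
  prodℤ (tabulate (λ i → delta (finCols X i) (finCols Y (V.lookup (swapEntries j k σ) i)))) ∎
  where
  open ≡-Reasoning
  g = λ i → delta (finCols X i) (finCols Y (V.lookup σ (transpose j k i)))

-- Reindexing sums along an involution

module _ {A : Set} where

  concatMap≡cartesianProductWith : ∀ {B C : Set} (f : A → B → C) xs ys →
    L.concatMap (λ x → map (f x) ys) xs ≡ L.cartesianProductWith f xs ys
  concatMap≡cartesianProductWith f []       ys = refl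
  concatMap≡cartesianProductWith f (x ∷ xs) ys = cong (map (f x) ys ++_) (concatMap≡cartesianProductWith f xs ys)

  allVec-unique : ∀ k {xs : List A} → Unique xs → Unique (allVec k xs)
  allVec-unique zero        _ = [] ∷ []
  allVec-unique (suc k) {xs} u = subst Unique (sym (concatMap≡cartesianProductWith V._∷_ xs (allVec k xs)))
    (UniqueP.cartesianProductWith⁺ V._∷_ VP.∷-injective u (allVec-unique k u))

  allVec-complete : ∀ k {xs : List A} → (∀ x → x ∈ xs) → ∀ v → v ∈ allVec k xs
  allVec-complete zero    _ V.[]       = here refl
  allVec-complete (suc k) {xs} c (x V.∷ v) = subst (_ ∈_) (sym (concatMap≡cartesianProductWith V._∷_ xs (allVec k xs)))
    (MP.∈-cartesianProductWith⁺ V._∷_ (c x) (allVec-complete k c v))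

module _ {B : Set} where

  involution-↭ : ∀ {xs : List B} → Unique xs → (∀ x → x ∈ xs) → (φ : B → B) → (∀ x → φ (φ x) ≡ x) →
    map φ xs ↭ xs
  involution-↭ {xs} unique complete φ involutive =
    ∼bag⇒↭ (unique∧set⇒bag (UniqueP.map⁺ φ-injective unique) unique
      (λ {x} → mk⇔ (λ _ → complete x) (λ _ → subst (_∈ map φ xs) (involutive x) (MP.∈-map⁺ φ (complete (φ x))))))
    where
    φ-injective : ∀ {x y} → φ x ≡ φ y → x ≡ y
    φ-injective {x} {y} eq = trans (sym (involutive x)) (trans (cong φ eq) (involutive y))

  sumℤ-reindex : ∀ {xs : List B} {φ : B → B} → map φ xs ↭ xs → ∀ h → sumℤ (map (h ∘ φ) xs) ≡ sumℤ (map h xs)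
  sumℤ-reindex {xs} p h = trans (cong sumℤ (LP.map-∘ xs)) (sumℤ-↭ (PermP.map⁺ h p))

  sumℚ-signReversing≡0 : ∀ {xs : List B} {φ : B → B} → map φ xs ↭ xs → ∀ f → (∀ x → f (φ x) ≡ ℚ.- f x) →
    sumℚ (map f xs) ≡ ℚ.0ℚ
  sumℚ-signReversing≡0 {xs} {φ} p f reverses = x≡-x⇒x≡0 (sumℚ (map f xs)) (begin
    sumℚ (map f xs)           ≡⟨ sumℚ-↭ (PermP.map⁺ f p) ⟨
    sumℚ (map f (map φ xs))   ≡⟨ cong sumℚ (LP.map-∘ xs) ⟨
    sumℚ (map (f ∘ φ) xs)     ≡⟨ cong sumℚ (LP.map-cong reverses xs) ⟩
    sumℚ (map (ℚ.-_ ∘ f) xs)  ≡⟨ sumℚ-map-neg f xs ⟩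
    ℚ.- sumℚ (map f xs)       ∎)
    where
    open ≡-Reasoning
    x≡-x⇒x≡0 : ∀ x → x ≡ ℚ.- x → x ≡ ℚ.0ℚ
    x≡-x⇒x≡0 x x≡-x = begin
      x                          ≡⟨ ℚP.*-identityˡ x ⟨
      (ℚ.½ ℚ.+ ℚ.½) ℚ.* x        ≡⟨ ℚP.*-distribʳ-+ x ℚ.½ ℚ.½ ⟩
      ℚ.½ ℚ.* x ℚ.+ ℚ.½ ℚ.* x    ≡⟨ ℚP.*-distribˡ-+ ℚ.½ x x ⟨
      ℚ.½ ℚ.* (x ℚ.+ x)          ≡⟨ cong (λ y → ℚ.½ ℚ.* (x ℚ.+ y)) x≡-x ⟩
      ℚ.½ ℚ.* (x ℚ.+ ℚ.- x)      ≡⟨ cong (ℚ.½ ℚ.*_) (ℚP.+-inverseʳ x) ⟩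
      ℚ.½ ℚ.* ℚ.0ℚ               ≡⟨ ℚP.*-zeroʳ ℚ.½ ⟩
      ℚ.0ℚ                       ∎

swapEntries-allVec-↭ : ∀ {A : Set} {m} {xs : List A} (j k : Fin m) → Unique xs → (∀ x → x ∈ xs) →
  map (swapEntries j k) (allVec m xs) ↭ allVec m xs
swapEntries-allVec-↭ {m = m} j k unique complete = involution-↭ (allVec-unique m unique)
  (allVec-complete m complete) (swapEntries j k) (swapEntries-involutive j k)

swapColumns-allTables-↭ : ∀ {n d m} (j k : Fin m) → map (swapColumns j k) (allTables n d m) ↭ allTables n d m
swapColumns-allTables-↭ {n} {d} {m} j k = involution-↭
  (allVec-unique d (allVec-unique m (UniqueP.allFin⁺ n))) (allVec-complete d (allVec-complete m MP.∈-allFin))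
  (swapColumns j k) (λ X → trans (sym (VP.map-∘ (swapEntries j k) (swapEntries j k) X))
                                 (trans (VP.map-cong (swapEntries-involutive j k) X) (VP.map-id X)))

module _ {n d m : ℕ} {j k : Fin m} (j<k : F.toℕ j < F.toℕ k) (Y X : Table (Fin n) d m) where

  private
    maps : List (Vec (Fin m) m)
    maps = allVec m (allFin m)

    ψ : Vec (Fin m) m → Vec (Fin m) m
    ψ = swapEntries j k

    sgnMap-swapped : ∀ σ → sgnMap σ ≡ ℤ.- sgnMap (ψ σ)
    sgnMap-swapped σ = trans (cong sgnMap (sym (swapEntries-involutive j k σ))) (sgnMap-swapEntries j<k (ψ σ))

    reindex : ∀ h → sumℤ (map (h ∘ ψ) maps) ≡ sumℤ (map h maps)
    reindex = sumℤ-reindex (swapEntries-allVec-↭ j k (UniqueP.allFin⁺ m) MP.∈-allFin)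

  extPair-swapColumns : extPair Y (swapColumns j k X) ≡ ℤ.- extPair Y X
  extPair-swapColumns = begin
    sumℤ (map (λ σ → sgnMap σ ℤ.* matchProd Y (swapColumns j k X) σ) maps)
      ≡⟨ cong sumℤ (LP.map-cong (λ σ → trans
           (cong₂ ℤ._*_ (sgnMap-swapped σ) (matchProd-swapColumns j<k Y X σ))
           (sym (ℤP.neg-distribˡ-* (sgnMap (ψ σ)) _))) maps) ⟩
    sumℤ (map (ℤ.-_ ∘ term ∘ ψ) maps)  ≡⟨ sumℤ-map-neg (term ∘ ψ) maps ⟩
    ℤ.- sumℤ (map (term ∘ ψ) maps)     ≡⟨ cong ℤ.-_ (reindex term) ⟩
    ℤ.- sumℤ (map term maps)           ∎
    where
    open ≡-Reasoning
    term : Vec (Fin m) m → ℤ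
    term σ = sgnMap σ ℤ.* matchProd Y X σ

  symPair-swapColumns : symPair Y (swapColumns j k X) ≡ symPair Y X
  symPair-swapColumns = begin
    sumℤ (map (λ σ → (sgnMap σ ℤ.* sgnMap σ) ℤ.* matchProd Y (swapColumns j k X) σ) maps)
      ≡⟨ cong sumℤ (LP.map-cong (λ σ → cong₂ ℤ._*_
           (trans (cong₂ ℤ._*_ (sgnMap-swapped σ) (sgnMap-swapped σ)) (neg-square (sgnMap (ψ σ))))
           (matchProd-swapColumns j<k Y X σ)) maps) ⟩
    sumℤ (map (term ∘ ψ) maps)  ≡⟨ reindex term ⟩
    sumℤ (map term maps)        ∎
    where
    open ≡-Reasoning
    term : Vec (Fin m) m → ℤ
    term σ = (sgnMap σ ℤ.* sgnMap σ) ℤ.* matchProd Y X σ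
    neg-square : ∀ a → (ℤ.- a) ℤ.* (ℤ.- a) ≡ a ℤ.* a
    neg-square = ℤSolver.solve-∀

neg-/ : ∀ i n .{{_ : ℕ.NonZero n}} → (ℤ.- i) ℚ./ n ≡ ℚ.- (i ℚ./ n)
neg-/ (+ zero)   n = trans (ℚP.0/n≡0 n) (cong ℚ.-_ (sym (ℚP.0/n≡0 n)))
neg-/ +[1+ i ]   n = refl
neg-/ -[1+ i ]   n = sym (ℚ-neg-involutive _)

coeff-neg : ∀ {n d m} (T : Table ℕ d m) {X X′ : Table (Fin n) d m} →
  sgnT T X′ ≡ ℤ.- sgnT T X → coeff T X′ ≡ ℚ.- coeff T X
coeff-neg T {X} neg = trans
  (cong (λ s → (s ℚ./ normT T) {{normT-nonZero T}})
        (trans (cong (signT T ℤ.*_) neg) (sym (ℤP.neg-distribʳ-* (signT T) (sgnT T X)))))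
  (neg-/ (signT T ℤ.* sgnT T X) (normT T) {{normT-nonZero T}})

coeff-cong : ∀ {n d m} (T : Table ℕ d m) {X X′ : Table (Fin n) d m} →
  sgnT T X′ ≡ sgnT T X → coeff T X′ ≡ coeff T X
coeff-cong T eq = cong (λ s → ((signT T ℤ.* s) ℚ./ normT T) {{normT-nonZero T}}) eq

module _ {n d m : ℕ} {j k : Fin m} (j<k : F.toℕ j < F.toℕ k) (T : Table ℕ d m) (same : column T j ≡ column T k) where

  equalColumns⇒DeltaZero : Odd d → DeltaZero n T
  equalColumns⇒DeltaZero odd Y = sumℚ-signReversing≡0 (swapColumns-allTables-↭ j k) _ (λ X → begin
    coeff T (swapColumns j k X) ℚ.* (symPair Y (swapColumns j k X) ℚ./ 1)
      ≡⟨ cong₂ ℚ._*_ (coeff-neg T (sgnT-odd X)) (cong (ℚ._/ 1) (symPair-swapColumns j<k Y X)) ⟩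
    ℚ.- coeff T X ℚ.* (symPair Y X ℚ./ 1)    ≡⟨ ℚP.neg-distribˡ-* (coeff T X) _ ⟨
    ℚ.- (coeff T X ℚ.* (symPair Y X ℚ./ 1))  ∎)
    where
    open ≡-Reasoning
    sgnT-odd : ∀ X → sgnT T (swapColumns j k X) ≡ ℤ.- sgnT T X
    sgnT-odd X = trans (sgnT-swapColumns j<k T same X)
      (trans (cong (ℤ._* sgnT T X) (negOnePow-odd d odd)) (ℤP.-1*i≡-i (sgnT T X)))

  equalColumns⇒NablaZero : Even d → NablaZero n T
  equalColumns⇒NablaZero even Y = sumℚ-signReversing≡0 (swapColumns-allTables-↭ j k) _ (λ X → begin
    coeff T (swapColumns j k X) ℚ.* (extPair Y (swapColumns j k X) ℚ./ 1)
      ≡⟨ cong₂ ℚ._*_ (coeff-cong T (sgnT-even X))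
                     (trans (cong (ℚ._/ 1) (extPair-swapColumns j<k Y X)) (neg-/ (extPair Y X) 1)) ⟩
    coeff T X ℚ.* ℚ.- (extPair Y X ℚ./ 1)    ≡⟨ ℚP.neg-distribʳ-* (coeff T X) _ ⟨
    ℚ.- (coeff T X ℚ.* (extPair Y X ℚ./ 1))  ∎)
    where
    open ≡-Reasoning
    sgnT-even : ∀ X → sgnT T (swapColumns j k X) ≡ sgnT T X
    sgnT-even X = trans (sgnT-swapColumns j<k T same X)
      (trans (cong (ℤ._* sgnT T X) (negOnePow-even d even)) (ℤP.*-identityˡ (sgnT T X)))

equalColumns-ordered : ∀ {d m} (T : Table ℕ d m) → HasEqualColumns T →
  ∃₂ λ j k → F.toℕ j < F.toℕ k × column T j ≡ column T k
equalColumns-ordered T (j , k , j≢k , same) with ℕP.<-cmp (F.toℕ j) (F.toℕ k)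
... | tri< j<k _ _ = j , k , j<k , same
... | tri≈ _ j≡k _ = ⊥-elim (j≢k (FP.toℕ-injective j≡k))
... | tri> _ _ k<j = k , j , k<j , sym same

mainTheorem9 : (n d m : ℕ) (λs : Vec (List ℕ) d) (T : Table ℕ d m)
    → ((i : Fin d) → IsPartition m (Data.Vec.lookup λs i))
    → InAtuple λs T
    → HasEqualColumns T
    → (Odd d → DeltaZero n T) × (Even d → NablaZero n T)
mainTheorem9 n d m λs T _ _ equal with j , k , j<k , same ← equalColumns-ordered T equal =
  equalColumns⇒DeltaZero j<k T same , equalColumns⇒NablaZero j<k T same
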